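{- Let $t$ be a non-negative integer and let $G$ be a 2-connected finite simple graph with circumference $t$. Then the treedepth of $G$ is at most $\lfloor \tfrac{t}{2}\rfloor (t-1)+1$.
   Context: The circumference of a graph is the length of a longest cycle (or $0$ if acyclic). In a rooted forest $F$, the height of a vertex is its distance to the root of its component, and the height of $F$ is the maximum height of its vertices. The closure of a rooted forest $F$ is the graph on $V(F)$ in which $x\neq y$ are adjacent iff one is an ancestor of the other. The treedepth of $G$ is the minimum, over rooted forests $F$ with $V(F)=V(G)$ such that $G$ is a subgraph of the closure of $F$, of the height of $F$ plus $1$. -}

module Defs where

open import Data.Nat using (ℕ; zero; suc; _≤_; _<_; _+_)
open import Data.Fin using (Fin; inject₁; fromℕ) renaming (zero to fzero; suc to fsuc)
open import Data.Maybe using (Maybe; just; nothing)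
open import Data.Product using (Σ; _×_)
open import Data.Sum using (_⊎_)
open import Data.Empty using (⊥)
open import Relation.Nullary using (¬_; Dec)
open import Relation.Binary.PropositionalEquality using (_≡_; _≢_)
open import Function.Definitions using (Injective)

record Graph (n : ℕ) : Set₁ where
  field
    Adj   : Fin n → Fin n → Set
    adj?  : ∀ u v → Dec (Adj u v)
    sym   : ∀ {u v} → Adj u v → Adj v u
    irrefl : ∀ {u} → ¬ Adj u u
open Graph public

-- Reach G P u v : there is a walk from u to v in G all of whose
-- vertices satisfy P (i.e. a walk in the induced subgraph G[P]).
data Reach {n : ℕ} (G : Graph n) (P : Fin n → Set) : Fin n → Fin n → Set where
  here  : ∀ {u} → P u → Reach G P u u
  step  : ∀ {u w v} → P u → Adj G u w → Reach G P w v → Reach G P u v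

TwoConnected : ∀ {n} → Graph n → Set
TwoConnected {n} G =
  (3 ≤ n) × (∀ (w u v : Fin n) → u ≢ w → v ≢ w → Reach G (λ x → x ≢ w) u v)

HasCycle : ∀ {n} → Graph n → ℕ → Set
HasCycle {n} G zero = ⊥
HasCycle {n} G (suc m) =
  (3 ≤ suc m) × Σ (Fin (suc m) → Fin n) λ c →
    Injective _≡_ _≡_ c
    × (∀ (i : Fin m) → Adj G (c (inject₁ i)) (c (fsuc i)))
    × Adj G (c (fromℕ m)) (c fzero)

Circumference : ∀ {n} → Graph n → ℕ → Set
Circumference G t =
  ((t ≡ 0) × (∀ k → ¬ HasCycle G k))
  ⊎ (HasCycle G t × (∀ k → HasCycle G k → k ≤ t))

-- A rooted forest on Fin n, given by a parent map together with a
-- height labelling (distance to the root) that witnesses acyclicity.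
record RootedForest (n : ℕ) : Set where
  field
    parent     : Fin n → Maybe (Fin n)
    height     : Fin n → ℕ
    root-h     : ∀ v → parent v ≡ nothing → height v ≡ 0
    child-h    : ∀ v u → parent v ≡ just u → height v ≡ suc (height u)
open RootedForest public

data Ancestor {n : ℕ} (F : RootedForest n) : Fin n → Fin n → Set where
  par   : ∀ {x y} → parent F y ≡ just x → Ancestor F x y
  up    : ∀ {x z y} → parent F y ≡ just z → Ancestor F x z → Ancestor F x y

ClosureAdj : ∀ {n} → RootedForest n → Fin n → Fin n → Set
ClosureAdj F x y = Ancestor F x y ⊎ Ancestor F y x

TreedepthAtMost : ∀ {n} → Graph n → ℕ → Set
TreedepthAtMost {n} G k =
  Σ (RootedForest n) λ F →
    (∀ u v → Adj G u v → ClosureAdj F u v)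
    × (∀ v → height F v + 1 ≤ k)

-- A depth-first search yields a normal spanning forest F: its edges are edges of G and every edge of
-- G joins a vertex to one of its ancestors, so G lies in the closure of F and it suffices to bound the
-- heights in F. Let v 0, …, v h be the root path of a vertex. Since G - v β is connected, the subtree
-- of v (β + 1) has an edge to some v a with a < β; take a minimal. The tree path from this edge back to
-- the branch closes a cycle with v a, …, v j, so each such jump is short. Sweeping β downwards from
-- h - 1, the jumps are chained into a path from v β to v α avoiding v 0, …, v α, which closes a last
-- cycle at β = 0. Counting jumps in pairs, each pair covers at most t - 3 vertices of the branch and
-- adds two vertices to the path; with c pairs this gives h ≤ (c + 1)(t - 3) + 2 and 2c + 1 ≤ t,
-- hence h ≤ ⌊t/2⌋ (t - 1).

module Submission where

open import Defs
open import Data.Nat using (ℕ; zero; suc; _+_; _*_; _∸_; _/_; _≤_; _<_; z≤n; s≤s; s≤s⁻¹; _≤?_)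
open import Data.Nat.Properties
open import Data.Nat.DivMod using (m≡m%n+[m/n]*n; m%n<n)
open import Data.Nat.Tactic.RingSolver using (solve-∀)
open import Data.Fin using (Fin; inject₁; fromℕ; punchIn; punchOut) renaming (zero to fzero; suc to fsuc)
open import Data.Fin.Properties
  using (any?; punchIn-injective; punchInᵢ≢i; punchIn-punchOut) renaming (_≟_ to _≟F_)
open import Data.Fin.Subset using (Subset; _-_; _─_; ⁅_⁆; ∣_∣; inside)
  renaming (_∈_ to _∈ₛ_; _∉_ to _∉ₛ_; ⊤ to full)
open import Data.Fin.Subset.Properties
  using (_∈?_; x∈p⇒∣p-x∣<∣p∣; x∈p∧x≢y⇒x∈p-y; ∈⊤; p─q⊆p; x∈⁅x⁆)
open import Data.Vec using (_∷_)
import Data.Vec as Vec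
open import Data.Bool using (Bool; true; false; not)
open import Data.Maybe using (Maybe; just; nothing; fromMaybe)
open import Data.Maybe.Properties using (just-injective)
open import Data.List using (List; []; _∷_; _++_; length; lookup; reverse)
open import Data.List.Properties using (unfold-reverse; length-++; length-reverse; ++-identityʳ)
open import Data.List.Membership.Propositional using (_∈_; _∉_)
open import Data.List.Membership.Propositional.Properties using (∈-lookup; ∈-++⁻)
open import Data.List.Relation.Unary.Any using (here; there)
open import Data.List.Relation.Unary.Any.Properties using (reverse⁻)
open import Data.List.Relation.Unary.All.Properties using (¬Any⇒All¬)
open import Data.List.Relation.Unary.AllPairs using ([]; _∷_)
open import Data.List.Relation.Unary.Unique.Propositional using (Unique)
open import Data.List.Relation.Unary.Unique.Propositional.Properties using (Unique[x∷xs]⇒x∉xs; ++⁺)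
open import Data.List.Relation.Binary.Permutation.Propositional using (↭-sym; ↭⇒↭ₛ)
open import Data.List.Relation.Binary.Permutation.Propositional.Properties using (↭-reverse)
import Data.List.Relation.Binary.Permutation.Setoid.Properties as PermutationProperties
open import Data.Product using (Σ; _×_; _,_; ∃; proj₁; proj₂)
open import Data.Sum using (_⊎_; inj₁; inj₂; map₂)
open import Data.Empty using (⊥; ⊥-elim)
open import Relation.Nullary using (¬_; Dec; yes; no)
open import Relation.Nullary.Decidable using (_×-dec_)
open import Relation.Unary using (Decidable)
open import Relation.Binary.Definitions using (tri<; tri≈; tri>)
open import Relation.Binary.PropositionalEquality as ≡
  using (_≡_; _≢_; refl; trans; cong; cong₂; subst; subst₂; module ≡-Reasoning)

module _ {P : ℕ → Set} (P? : Decidable P) where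

  private
    search : ∀ k → (∃ λ m → P m × (∀ {j} → j < m → ¬ P j)) ⊎ (∀ {j} → j < k → ¬ P j)
    search zero = inj₂ λ ()
    search (suc k) with search k
    ... | inj₁ found = inj₁ found
    ... | inj₂ none with P? k
    ...   | yes pk = inj₁ (k , pk , none)
    ...   | no ¬pk = inj₂ λ j<1+k → below (m≤n⇒m<n∨m≡n (s≤s⁻¹ j<1+k))
      where
        below : ∀ {j} → j < k ⊎ j ≡ k → ¬ P j
        below (inj₁ j<k)  = none j<k
        below (inj₂ refl) = ¬pk

  minimal-witness : ∀ {k} → P k → ∃ λ m → m ≤ k × P m × (∀ {j} → j < m → ¬ P j)
  minimal-witness {k} pk with search (suc k)
  ... | inj₁ (m , pm , minimal) = m , ≮⇒≥ (λ k<m → minimal k<m pk) , pm , minimal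
  ... | inj₂ none               = ⊥-elim (none ≤-refl pk)

gap-split : ∀ {a β j} → a < β → suc β ≤ j → ∃ λ e → j ≡ suc (a + e) × 1 ≤ e
gap-split {a} a<β β<j with m≤n⇒∃[o]m+o≡n (≤-trans (s≤s a<β) β<j)
... | o , 2+a+o≡j = suc o , ≡.sym (trans (cong suc (+-suc a o)) 2+a+o≡j) , s≤s z≤n

module _ {A : Set} where

  unique-∷ : ∀ {x : A} {xs} → x ∉ xs → Unique xs → Unique (x ∷ xs)
  unique-∷ {xs = xs} x∉xs u = ¬Any⇒All¬ xs x∉xs ∷ u

  unique-reverse : ∀ {xs : List A} → Unique xs → Unique (reverse xs)
  unique-reverse {xs} =
    PermutationProperties.Unique-resp-↭ (≡.setoid A) (↭⇒↭ₛ (↭-sym (↭-reverse xs)))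

  lookup-injective : ∀ {xs : List A} → Unique xs → ∀ {i j} → lookup xs i ≡ lookup xs j → i ≡ j
  lookup-injective {_ ∷ _}  _ {fzero}  {fzero}  _ = refl
  lookup-injective {_ ∷ xs} u {fzero}  {fsuc j} e =
    ⊥-elim (Unique[x∷xs]⇒x∉xs u (subst (_∈ xs) (≡.sym e) (∈-lookup j)))
  lookup-injective {_ ∷ xs} u {fsuc i} {fzero}  e =
    ⊥-elim (Unique[x∷xs]⇒x∉xs u (subst (_∈ xs) e (∈-lookup i)))
  lookup-injective {_ ∷ _} (_ ∷ u) {fsuc i} {fsuc j} e = cong fsuc (lookup-injective u e)

-- xs lists the interior vertices of the walk from u to w.
data Walk {n : ℕ} (G : Graph n) : Fin n → List (Fin n) → Fin n → Set where
  edge : ∀ {u w} → Adj G u w → Walk G u [] w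
  _◅_  : ∀ {u x xs w} → Adj G u x → Walk G x xs w → Walk G u (x ∷ xs) w

infixr 5 _◅_

module _ {n : ℕ} {G : Graph n} where

  walk-++ : ∀ {u xs m ys w} → Walk G u xs m → Walk G m ys w → Walk G u (xs ++ m ∷ ys) w
  walk-++ (edge um) mw = um ◅ mw
  walk-++ (ux ◅ p)  mw = ux ◅ walk-++ p mw

  walk-reverse : ∀ {u xs w} → Walk G u xs w → Walk G w (reverse xs) u
  walk-reverse (edge uw) = edge (sym G uw)
  walk-reverse {u} {x ∷ xs} {w} (ux ◅ p) =
    subst (λ ys → Walk G w ys u) (≡.sym (unfold-reverse x xs)) (walk-++ (walk-reverse p) (edge (sym G ux)))

  private
    walk-lookup : ∀ {x R w} → Walk G x R w →
      (∀ (i : Fin (length R)) → Adj G (lookup (x ∷ R) (inject₁ i)) (lookup (x ∷ R) (fsuc i))) ×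
      Adj G (lookup (x ∷ R) (fromℕ (length R))) w
    walk-lookup (edge xw) = (λ ()) , xw
    walk-lookup (xy ◅ p) with walk-lookup p
    ... | steps , last = (λ { fzero → xy ; (fsuc i) → steps i }) , last

  closedWalk⇒cycle : ∀ {x R} → Walk G x R x → Unique (x ∷ R) → 2 ≤ length R →
                     HasCycle G (suc (length R))
  closedWalk⇒cycle {x} {R} p u 2≤ = s≤s 2≤ , lookup (x ∷ R) , lookup-injective u , walk-lookup p

module Ancestry {n : ℕ} (F : RootedForest n) where

  parentOrSelf : Fin n → Fin n
  parentOrSelf y = fromMaybe y (parent F y)

  climb : Fin n → ℕ → Fin n
  climb y zero    = y
  climb y (suc k) = climb (parentOrSelf y) k

  climb-+ : ∀ y k m → climb y (k + m) ≡ climb (climb y k) m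
  climb-+ y zero    m = refl
  climb-+ y (suc k) m = climb-+ (parentOrSelf y) k m

  hasParent : ∀ y → 0 < height F y → ∃ λ p → parent F y ≡ just p
  hasParent y 0<h with parent F y in eq
  ... | just p  = p , refl
  ... | nothing = ⊥-elim (<⇒≢ 0<h (≡.sym (root-h F y eq)))

  parentOrSelf-just : ∀ {y p} → parent F y ≡ just p → parentOrSelf y ≡ p
  parentOrSelf-just e rewrite e = refl

  height-climb : ∀ y k → k ≤ height F y → height F (climb y k) + k ≡ height F y
  height-climb y zero    _   = +-identityʳ _
  height-climb y (suc k) k<h with hasParent y (≤-<-trans z≤n k<h)
  ... | p , ep rewrite ep = begin
    height F (climb p k) + suc k  ≡⟨ +-suc _ k ⟩
    suc (height F (climb p k) + k) ≡⟨ cong suc (height-climb p k k≤hp) ⟩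
    suc (height F p)               ≡⟨ ≡.sym (child-h F y p ep) ⟩
    height F y                     ∎
    where
      open ≡-Reasoning
      k≤hp : k ≤ height F p
      k≤hp = s≤s⁻¹ (subst (suc k ≤_) (child-h F y p ep) k<h)

  -- x is y or an ancestor of y; the height clause keeps climb from idling at a root.
  _≼_ : Fin n → Fin n → Set
  x ≼ y = Σ ℕ λ k → (climb y k ≡ x) × (height F y ≡ k + height F x)

  Comparable : Fin n → Fin n → Set
  Comparable x y = x ≼ y ⊎ y ≼ x

  ≼-refl : ∀ x → x ≼ x
  ≼-refl x = 0 , refl , refl

  ≼-trans : ∀ {x y z} → x ≼ y → y ≼ z → x ≼ z
  ≼-trans {x} {y} {z} (k , ex , hx) (m , ey , hy) =
    m + k ,
    trans (climb-+ z m k) (trans (cong (λ w → climb w k) ey) ex) ,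
    trans hy (trans (cong (m +_) hx) (≡.sym (+-assoc m k (height F x))))

  ≼⇒height≤ : ∀ {x y} → x ≼ y → height F x ≤ height F y
  ≼⇒height≤ {x} (k , _ , e) = subst (height F x ≤_) (≡.sym e) (m≤n+m (height F x) k)

  ≼∧height≡⇒≡ : ∀ {x y} → x ≼ y → height F x ≡ height F y → x ≡ y
  ≼∧height≡⇒≡ (zero  , e , _) _ = ≡.sym e
  ≼∧height≡⇒≡ {x} (suc k , e , h) q = ⊥-elim (<⇒≢ (s≤s (m≤n+m (height F x) k)) (trans q h))

  climb≼ : ∀ y k → k ≤ height F y → climb y k ≼ y
  climb≼ y k k≤h = k , refl , trans (≡.sym (height-climb y k k≤h)) (+-comm _ k)

  private
    climb-≼-climb : ∀ {z k m} → m ≤ k → k ≤ height F z → climb z k ≼ climb z m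
    climb-≼-climb {z} {k} {m} m≤k k≤h =
      subst (_≼ climb z m) x≡ (climb≼ (climb z m) (k ∸ m) k∸m≤)
      where
        x≡ : climb (climb z m) (k ∸ m) ≡ climb z k
        x≡ = trans (≡.sym (climb-+ z m (k ∸ m))) (cong (climb z) (m+[n∸m]≡n m≤k))
        k∸m≤ : k ∸ m ≤ height F (climb z m)
        k∸m≤ = +-cancelʳ-≤ m (k ∸ m) _
                 (subst₂ _≤_ (≡.sym (m∸n+n≡m m≤k)) (≡.sym (height-climb z m (≤-trans m≤k k≤h))) k≤h)

  ≼-linear : ∀ {x y z} → x ≼ z → y ≼ z → Comparable x y
  ≼-linear {x} {y} {z} (k , refl , hx) (m , refl , hy) with ≤-total m k
  ... | inj₁ m≤k = inj₁ (climb-≼-climb m≤k (subst (k ≤_) (≡.sym hx) (m≤m+n k _)))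
  ... | inj₂ k≤m = inj₂ (climb-≼-climb k≤m (subst (m ≤_) (≡.sym hy) (m≤m+n m _)))

  parent≼ : ∀ {y p} → parent F y ≡ just p → p ≼ y
  parent≼ {y} {p} e = 1 , parentOrSelf-just e , child-h F y p e

  ≼-parent : ∀ {x y p} → x ≼ y → x ≢ y → parent F y ≡ just p → x ≼ p
  ≼-parent (zero , e , _) x≢y _ = ⊥-elim (x≢y (≡.sym e))
  ≼-parent {x} {y} {p} (suc k , e , h) _ ep =
    k , trans (cong (λ w → climb w k) (≡.sym (parentOrSelf-just ep))) e ,
    suc-injective (trans (≡.sym (child-h F y p ep)) h)

  ≼-root : ∀ {x y} → parent F y ≡ nothing → x ≼ y → x ≡ y
  ≼-root _ (zero , e , _) = ≡.sym e
  ≼-root {y = y} ey (suc k , _ , h) with trans (≡.sym (root-h F y ey)) h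
  ... | ()

  _≼?_ : ∀ x y → Dec (x ≼ y)
  x ≼? y with height F x ≤? height F y
  ... | no hx≰hy = no λ x≼y → hx≰hy (≼⇒height≤ x≼y)
  ... | yes hx≤hy with climb y (height F y ∸ height F x) ≟F x
  ... | yes e = yes (height F y ∸ height F x , e , ≡.sym (m∸n+n≡m hx≤hy))
  ... | no ne = no λ { (k , e , h) →
          ne (subst (λ k′ → climb y k′ ≡ x)
                    (≡.sym (trans (cong (_∸ height F x) h) (m+n∸n≡m k (height F x)))) e) }

  ≼∧≢⇒Ancestor : ∀ {x y} → x ≼ y → x ≢ y → Ancestor F x y
  ≼∧≢⇒Ancestor (k , e , h) = go k e h
    where
      go : ∀ k {x y} → climb y k ≡ x → height F y ≡ k + height F x → x ≢ y → Ancestor F x y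
      go zero    e _ x≢y = ⊥-elim (x≢y (≡.sym e))
      go (suc k) {x} {y} e h x≢y with hasParent y (subst (0 <_) (≡.sym h) (s≤s z≤n))
      ... | p , ep with x ≟F p
      ... | yes refl = par ep
      ... | no x≢p = up ep (go k (trans (cong (λ w → climb w k) (≡.sym (parentOrSelf-just ep))) e)
                                  (suc-injective (trans (≡.sym (child-h F y p ep)) h)) x≢p)

  comparable⇒closureAdj : ∀ {x y} → Comparable x y → x ≢ y → ClosureAdj F x y
  comparable⇒closureAdj (inj₁ x≼y) x≢y = inj₁ (≼∧≢⇒Ancestor x≼y x≢y)
  comparable⇒closureAdj (inj₂ y≼x) x≢y = inj₂ (≼∧≢⇒Ancestor y≼x (λ y≡x → x≢y (≡.sym y≡x)))

x∈p─q⇒x∉q : ∀ {m} (p q : Subset m) {x} → x ∈ₛ p ─ q → x ∉ₛ q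
x∈p─q⇒x∉q (_ ∷ p) (inside ∷ q) () Vec.here
x∈p─q⇒x∉q (_ ∷ p) (_ ∷ q) (Vec.there x∈) (Vec.there x∈q) = x∈p─q⇒x∉q p q x∈ x∈q

x∈p-y⇒x≢y : ∀ {m} {p : Subset m} {x y} → x ∈ₛ p - y → x ≢ y
x∈p-y⇒x≢y {p = p} {x} x∈ refl = x∈p─q⇒x∉q p ⁅ x ⁆ x∈ (x∈⁅x⁆ x)

x∉p⇒x∉p-y : ∀ {m} {p : Subset m} {x y} → x ∉ₛ p → x ∉ₛ p - y
x∉p⇒x∉p-y {p = p} {y = y} x∉p x∈ = x∉p (p─q⊆p p ⁅ y ⁆ x∈)

module Graft {n : ℕ} (F : RootedForest n) (w c : Fin n) (c≢w : c ≢ w)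
             (childless : ∀ v u → parent F v ≡ just u → u ≢ w) where
  open Ancestry F

  parent′ : Fin n → Maybe (Fin n)
  parent′ y with y ≟F w
  ... | yes _ = just c
  ... | no _  = parent F y

  height′ : Fin n → ℕ
  height′ y with y ≟F w
  ... | yes _ = suc (height F c)
  ... | no _  = height F y

  parent′-w : parent′ w ≡ just c
  parent′-w with w ≟F w
  ... | yes _  = refl
  ... | no w≢w = ⊥-elim (w≢w refl)

  parent′-≢ : ∀ {y} → y ≢ w → parent′ y ≡ parent F y
  parent′-≢ {y} y≢w with y ≟F w
  ... | yes y≡w = ⊥-elim (y≢w y≡w)
  ... | no _    = refl

  height′-w : height′ w ≡ suc (height F c)
  height′-w with w ≟F w
  ... | yes _  = refl
  ... | no w≢w = ⊥-elim (w≢w refl)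

  height′-≢ : ∀ {y} → y ≢ w → height′ y ≡ height F y
  height′-≢ {y} y≢w with y ≟F w
  ... | yes y≡w = ⊥-elim (y≢w y≡w)
  ... | no _    = refl

  F′ : RootedForest n
  F′ = record { parent = parent′ ; height = height′ ; root-h = root-h′ ; child-h = child-h′ }
    where
      root-h′ : ∀ v → parent′ v ≡ nothing → height′ v ≡ 0
      root-h′ v e with v ≟F w
      root-h′ v () | yes _
      ... | no _ = root-h F v e
      child-h′ : ∀ v u → parent′ v ≡ just u → height′ v ≡ suc (height′ u)
      child-h′ v u e with v ≟F w
      child-h′ v u refl | yes _ = cong suc (≡.sym (height′-≢ c≢w))
      ... | no _ = trans (child-h F v u e) (cong suc (≡.sym (height′-≢ (childless v u e))))

  module A′ = Ancestry F′

  private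
    parentOrSelf-≢ : ∀ y → y ≢ w → parentOrSelf y ≢ w
    parentOrSelf-≢ y y≢w with parent F y in eq
    ... | nothing = y≢w
    ... | just p  = childless y p eq

    climb-≢ : ∀ y k → y ≢ w → climb y k ≢ w
    climb-≢ y zero    y≢w = y≢w
    climb-≢ y (suc k) y≢w = climb-≢ (parentOrSelf y) k (parentOrSelf-≢ y y≢w)

    climb′-≢ : ∀ y k → y ≢ w → A′.climb y k ≡ climb y k
    climb′-≢ y zero    _   = refl
    climb′-≢ y (suc k) y≢w rewrite parent′-≢ y≢w =
      climb′-≢ (parentOrSelf y) k (parentOrSelf-≢ y y≢w)

  ≼⇒≼′ : ∀ {x y} → y ≢ w → x ≼ y → x A′.≼ y
  ≼⇒≼′ {x} {y} y≢w (k , e , h) =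
    k , trans (climb′-≢ y k y≢w) e ,
    trans (height′-≢ y≢w) (trans h (cong (k +_) (≡.sym (height′-≢ x≢w))))
    where
      x≢w : x ≢ w
      x≢w x≡w = climb-≢ y k y≢w (trans e x≡w)

  ≼c⇒≼′w : ∀ {x} → x ≼ c → x A′.≼ w
  ≼c⇒≼′w x≼c = A′.≼-trans (≼⇒≼′ c≢w x≼c) (A′.parent≼ parent′-w)

module DepthFirstSearch {n : ℕ} (G : Graph n) where
  OnStack : RootedForest n → Maybe (Fin n) → Fin n → Set
  OnStack F nothing  u = ⊥
  OnStack F (just c) u = Ancestry._≼_ F u c

  stackSize : RootedForest n → Maybe (Fin n) → ℕ
  stackSize F nothing  = 0
  stackSize F (just c) = suc (height F c)

  -- The stack of the search is the root path of the current vertex.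
  record Search : Set where
    field
      forest             : RootedForest n
      unvisited          : Subset n
      current            : Maybe (Fin n)
      unvisited-root     : ∀ v → v ∈ₛ unvisited → parent forest v ≡ nothing
      parent-visited     : ∀ v p → parent forest v ≡ just p → p ∉ₛ unvisited
      parent-adj         : ∀ v p → parent forest v ≡ just p → Adj G p v
      visited-comparable : ∀ u v → u ∉ₛ unvisited → v ∉ₛ unvisited → Adj G u v →
                           Ancestry.Comparable forest u v
      finished-closed    : ∀ u → u ∉ₛ unvisited → ¬ OnStack forest current u →
                           ∀ w → Adj G u w → w ∉ₛ unvisited
      current-visited    : ∀ c → current ≡ just c → c ∉ₛ unvisited

  -- Visiting a vertex lowers 2 ∣unvisited∣ by 2 and pushes one vertex; popping lowers the stack.
  potential : Search → ℕ
  potential s = 2 * ∣ Search.unvisited s ∣ + stackSize (Search.forest s) (Search.current s)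

  Finished : Search → Set
  Finished s = ∀ u → u ∉ₛ Search.unvisited s

  Progress : Search → Set
  Progress s = Σ Search λ s′ → potential s′ < potential s

  private
    2*-mono-< : ∀ {a b} → a < b → 2 * a + 1 < 2 * b
    2*-mono-< {a} {b} lt =
      subst (_≤ 2 * b) (trans (*-suc 2 a) (trans (+-comm 2 (2 * a)) (+-suc (2 * a) 1))) (*-monoʳ-≤ 2 lt)

  startTree : (s : Search) → Search.current s ≡ nothing → ∀ u → u ∈ₛ Search.unvisited s → Progress s
  startTree s no-current u u-new = s′ , decrease
    where
      open Search s
      open Ancestry forest
      U′ : Subset n
      U′ = unvisited - u
      stays-visited : ∀ v → v ∉ₛ U′ → v ≢ u → v ∉ₛ unvisited
      stays-visited v v∉U′ v≢u v∈U = v∉U′ (x∈p∧x≢y⇒x∈p-y v∈U v≢u)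
      closed : ∀ v → v ∉ₛ unvisited → ∀ w → Adj G v w → w ∉ₛ unvisited
      closed v v∉U = finished-closed v v∉U (subst (λ m → ¬ OnStack forest m v) (≡.sym no-current) (λ ()))
      comparable : ∀ a b → a ∉ₛ U′ → b ∉ₛ U′ → Adj G a b → Comparable a b
      comparable a b a∉ b∉ ab with a ≟F u | b ≟F u
      ... | yes refl | yes refl = ⊥-elim (irrefl G ab)
      ... | yes refl | no b≢u   = ⊥-elim (closed b (stays-visited b b∉ b≢u) a (sym G ab) u-new)
      ... | no a≢u   | yes refl = ⊥-elim (closed a (stays-visited a a∉ a≢u) b ab u-new)
      ... | no a≢u   | no b≢u   =
        visited-comparable a b (stays-visited a a∉ a≢u) (stays-visited b b∉ b≢u) ab
      finished : ∀ v → v ∉ₛ U′ → ¬ v ≼ u → ∀ w → Adj G v w → w ∉ₛ U′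
      finished v v∉ v⋠u w vw with v ≟F u
      ... | yes refl = ⊥-elim (v⋠u (≼-refl v))
      ... | no v≢u   = x∉p⇒x∉p-y (closed v (stays-visited v v∉ v≢u) w vw)
      s′ : Search
      s′ = record
        { forest = forest ; unvisited = U′ ; current = just u
        ; unvisited-root = λ v v∈ → unvisited-root v (p─q⊆p unvisited ⁅ u ⁆ v∈)
        ; parent-visited = λ v p e p∈ → parent-visited v p e (p─q⊆p unvisited ⁅ u ⁆ p∈)
        ; parent-adj = parent-adj
        ; visited-comparable = comparable
        ; finished-closed = finished
        ; current-visited = λ { c refl c∈ → x∈p-y⇒x≢y c∈ refl } }
      decrease : potential s′ < potential s
      decrease rewrite no-current | root-h forest u (unvisited-root u u-new) | +-identityʳ (2 * ∣ unvisited ∣) =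
        2*-mono-< (x∈p⇒∣p-x∣<∣p∣ u-new)

  descend : (s : Search) → ∀ c → Search.current s ≡ just c →
            ∀ w → w ∈ₛ Search.unvisited s → Adj G c w → Progress s
  descend s c at-c w w-new cw = s′ , decrease
    where
      open Search s
      open Ancestry forest
      c-visited : c ∉ₛ unvisited
      c-visited = current-visited c at-c
      c≢w : c ≢ w
      c≢w refl = c-visited w-new
      childless : ∀ v u → parent forest v ≡ just u → u ≢ w
      childless v u e refl = parent-visited v u e w-new
      open Graft forest w c c≢w childless
      U′ : Subset n
      U′ = unvisited - w
      stays-visited : ∀ v → v ∉ₛ U′ → v ≢ w → v ∉ₛ unvisited
      stays-visited v v∉U′ v≢w v∈U = v∉U′ (x∈p∧x≢y⇒x∈p-y v∈U v≢w)
      closed : ∀ v → v ∉ₛ unvisited → ¬ v ≼ c → ∀ x → Adj G v x → x ∉ₛ unvisited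
      closed v v∉U v⋠c = finished-closed v v∉U (subst (λ m → ¬ OnStack forest m v) (≡.sym at-c) v⋠c)
      w-parent : ∀ {v p} → v ≡ w → parent′ v ≡ just p → p ≡ c
      w-parent refl e = just-injective (trans (≡.sym e) parent′-w)
      comparable : ∀ a b → a ∉ₛ U′ → b ∉ₛ U′ → Adj G a b → A′.Comparable a b
      comparable a b a∉ b∉ ab = by-cases (a ≟F w) (b ≟F w)
        where
          by-cases : Dec (a ≡ w) → Dec (b ≡ w) → A′.Comparable a b
          by-cases (yes a≡w) (yes b≡w) = ⊥-elim (irrefl G (subst₂ (Adj G) a≡w b≡w ab))
          by-cases (yes a≡w) (no b≢w) with b ≼? c
          ... | yes b≼c = inj₂ (subst (b A′.≼_) (≡.sym a≡w) (≼c⇒≼′w b≼c))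
          ... | no b⋠c  = ⊥-elim (closed b (stays-visited b b∉ b≢w) b⋠c a (sym G ab)
                                   (subst (_∈ₛ unvisited) (≡.sym a≡w) w-new))
          by-cases (no a≢w) (yes b≡w) with a ≼? c
          ... | yes a≼c = inj₁ (subst (a A′.≼_) (≡.sym b≡w) (≼c⇒≼′w a≼c))
          ... | no a⋠c  = ⊥-elim (closed a (stays-visited a a∉ a≢w) a⋠c b ab
                                   (subst (_∈ₛ unvisited) (≡.sym b≡w) w-new))
          by-cases (no a≢w) (no b≢w)
            with visited-comparable a b (stays-visited a a∉ a≢w) (stays-visited b b∉ b≢w) ab
          ... | inj₁ a≼b = inj₁ (≼⇒≼′ b≢w a≼b)
          ... | inj₂ b≼a = inj₂ (≼⇒≼′ a≢w b≼a)
      finished : ∀ v → v ∉ₛ U′ → ¬ v A′.≼ w → ∀ x → Adj G v x → x ∉ₛ U′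
      finished v v∉ v⋠w x vx = by-cases (v ≟F w)
        where
          by-cases : Dec (v ≡ w) → x ∉ₛ U′
          by-cases (yes v≡w) = ⊥-elim (v⋠w (subst (v A′.≼_) v≡w (A′.≼-refl v)))
          by-cases (no v≢w)  =
            x∉p⇒x∉p-y (closed v (stays-visited v v∉ v≢w) (λ v≼c → v⋠w (≼c⇒≼′w v≼c)) x vx)
      parent′-visited : ∀ v p → parent′ v ≡ just p → p ∉ₛ U′
      parent′-visited v p e = by-cases (v ≟F w)
        where
          by-cases : Dec (v ≡ w) → p ∉ₛ U′
          by-cases (yes v≡w) = subst (_∉ₛ U′) (≡.sym (w-parent v≡w e)) (x∉p⇒x∉p-y c-visited)
          by-cases (no v≢w)  = x∉p⇒x∉p-y (parent-visited v p (trans (≡.sym (parent′-≢ v≢w)) e))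
      parent′-adj : ∀ v p → parent′ v ≡ just p → Adj G p v
      parent′-adj v p e = by-cases (v ≟F w)
        where
          by-cases : Dec (v ≡ w) → Adj G p v
          by-cases (yes v≡w) = subst₂ (Adj G) (≡.sym (w-parent v≡w e)) (≡.sym v≡w) cw
          by-cases (no v≢w)  = parent-adj v p (trans (≡.sym (parent′-≢ v≢w)) e)
      s′ : Search
      s′ = record
        { forest = F′ ; unvisited = U′ ; current = just w
        ; unvisited-root = λ v v∈ →
            trans (parent′-≢ (x∈p-y⇒x≢y v∈)) (unvisited-root v (p─q⊆p unvisited ⁅ w ⁆ v∈))
        ; parent-visited = parent′-visited
        ; parent-adj = parent′-adj
        ; visited-comparable = comparable
        ; finished-closed = finished
        ; current-visited = λ { x refl x∈ → x∈p-y⇒x≢y x∈ refl } }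
      decrease : potential s′ < potential s
      decrease = subst₂ _<_ (cong (λ z → 2 * ∣ U′ ∣ + suc z) (≡.sym height′-w))
                            (cong (λ m → 2 * ∣ unvisited ∣ + stackSize forest m) (≡.sym at-c))
                            (arith (x∈p⇒∣p-x∣<∣p∣ w-new))
        where
          arith : ∀ {a b x} → a < b → 2 * a + suc (suc x) < 2 * b + suc x
          arith {a} {b} {x} a<b =
            subst (_≤ 2 * b + suc x) (≡.sym (cong suc (+-suc (2 * a) (suc x))))
              (+-monoˡ-≤ (suc x) (subst (_≤ 2 * b) (*-suc 2 a) (*-monoʳ-≤ 2 a<b)))

  backtrack : (s : Search) → ∀ c → Search.current s ≡ just c →
              (∀ w → w ∈ₛ Search.unvisited s → ¬ Adj G c w) → Progress s
  backtrack s c at-c c-done = s′ , decrease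
    where
      open Search s
      open Ancestry forest
      closed : ∀ v → v ∉ₛ unvisited → ¬ v ≼ c → ∀ x → Adj G v x → x ∉ₛ unvisited
      closed v v∉U v⋠c = finished-closed v v∉U (subst (λ m → ¬ OnStack forest m v) (≡.sym at-c) v⋠c)
      finished : ∀ v → v ∉ₛ unvisited → ¬ OnStack forest (parent forest c) v →
                 ∀ x → Adj G v x → x ∉ₛ unvisited
      finished v v∉U off x vx with v ≼? c
      ... | no v⋠c = closed v v∉U v⋠c x vx
      ... | yes v≼c with v ≟F c
      ... | yes refl = λ x∈ → c-done x x∈ vx
      ... | no v≢c with parent forest c in ep
      ... | nothing = ⊥-elim (v≢c (≼-root ep v≼c))
      ... | just p  = ⊥-elim (off (≼-parent v≼c v≢c ep))
      s′ : Search
      s′ = record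
        { forest = forest ; unvisited = unvisited ; current = parent forest c
        ; unvisited-root = unvisited-root ; parent-visited = parent-visited
        ; parent-adj = parent-adj ; visited-comparable = visited-comparable
        ; finished-closed = finished
        ; current-visited = λ p e → parent-visited c p e }
      decrease : potential s′ < potential s
      decrease rewrite at-c with parent forest c in ep
      ... | nothing = +-monoʳ-< (2 * ∣ unvisited ∣) (s≤s z≤n)
      ... | just p  = +-monoʳ-< (2 * ∣ unvisited ∣) (≤-reflexive (≡.sym (cong suc (child-h forest c p ep))))

  searchStep : (s : Search) → Finished s ⊎ Progress s
  searchStep s = from (Search.current s) refl
    where
      from : ∀ m → Search.current s ≡ m → Finished s ⊎ Progress s
      from nothing at with any? (λ u → u ∈? Search.unvisited s)
      ... | yes (u , u-new) = inj₂ (startTree s at u u-new)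
      ... | no none         = inj₁ (λ u u-new → none (u , u-new))
      from (just c) at with any? (λ w → w ∈? Search.unvisited s ×-dec adj? G c w)
      ... | yes (w , w-new , cw) = inj₂ (descend s c at w w-new cw)
      ... | no none              = inj₂ (backtrack s c at (λ w w-new cw → none (w , w-new , cw)))

  runSearch : ∀ m → (s : Search) → potential s < m → Σ Search Finished
  runSearch (suc m) s bound with searchStep s
  ... | inj₁ done        = s , done
  ... | inj₂ (s′ , down) = runSearch m s′ (≤-trans down (s≤s⁻¹ bound))

  initial : Search
  initial = record
    { forest = record { parent = λ _ → nothing ; height = λ _ → 0
                      ; root-h = λ _ _ → refl ; child-h = λ _ _ () }
    ; unvisited = full ; current = nothing
    ; unvisited-root = λ _ _ → refl
    ; parent-visited = λ _ _ ()
    ; parent-adj = λ _ _ ()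
    ; visited-comparable = λ u _ u∉ _ _ → ⊥-elim (u∉ ∈⊤)
    ; finished-closed = λ _ u∉ _ _ _ _ → u∉ ∈⊤
    ; current-visited = λ _ () }

record NormalForest {n : ℕ} (G : Graph n) : Set where
  field
    forest         : RootedForest n
    parent-adj     : ∀ v p → parent forest v ≡ just p → Adj G p v
    adj⇒comparable : ∀ u v → Adj G u v → Ancestry.Comparable forest u v

normalForest : ∀ {n} (G : Graph n) → NormalForest G
normalForest G = fromFinished (runSearch (suc (potential initial)) initial ≤-refl)
  where
    open DepthFirstSearch G
    fromFinished : Σ Search Finished → NormalForest G
    fromFinished (s , done) = record
      { forest = forest
      ; parent-adj = parent-adj
      ; adj⇒comparable = λ u v uv → visited-comparable u v (done u) (done v) uv }
      where open Search s

reach-start : ∀ {n} {G : Graph n} {P u w} → Reach G P u w → P u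
reach-start (here pu)     = pu
reach-start (step pu _ _) = pu

module Exits {n : ℕ} {G : Graph n} (N : NormalForest G) where
  open NormalForest N
  open Ancestry forest

  private
    leave : ∀ {Q u w} y → Reach G Q u w → y ≼ u → ¬ y ≼ w →
            Σ (Fin n) λ x → Σ (Fin n) λ z → y ≼ x × Adj G x z × Q z × ¬ y ≼ z
    leave y (here _) y≼u y⋠w = ⊥-elim (y⋠w y≼u)
    leave {u = u} y (step {w = u′} _ uu′ r) y≼u y⋠w with y ≼? u′
    ... | yes y≼u′ = leave y r y≼u′ y⋠w
    ... | no y⋠u′  = u , u′ , y≼u , uu′ , reach-start r , y⋠u′

  -- The edge leaving the subtree goes to an ancestor of y, since every edge joins comparable vertices.
  exit : ∀ {Q u w} y → Reach G Q u w → y ≼ u → ¬ y ≼ w →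
         Σ (Fin n) λ x → Σ (Fin n) λ z → y ≼ x × Adj G x z × Q z × z ≼ y × z ≢ y
  exit y r y≼u y⋠w with leave y r y≼u y⋠w
  ... | x , z , y≼x , xz , qz , y⋠z with adj⇒comparable x z xz
  ...   | inj₁ x≼z = ⊥-elim (y⋠z (≼-trans y≼x x≼z))
  ...   | inj₂ z≼x with ≼-linear z≼x y≼x
  ...     | inj₁ z≼y = x , z , y≼x , xz , qz , z≼y , λ z≡y → y⋠z (subst (y ≼_) (≡.sym z≡y) (≼-refl y))
  ...     | inj₂ y≼z = ⊥-elim (y⋠z y≼z)

module Branch {n : ℕ} {G : Graph n} (N : NormalForest G) (ℓ : Fin n) where
  open NormalForest N
  open Ancestry forest

  h : ℕ
  h = height forest ℓ

  v : ℕ → Fin n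
  v i = climb ℓ (h ∸ i)

  height-v : ∀ {i} → i ≤ h → height forest (v i) ≡ i
  height-v {i} i≤h = +-cancelʳ-≡ (h ∸ i) _ i
    (trans (height-climb ℓ (h ∸ i) (m∸n≤m h i)) (≡.sym (m+[n∸m]≡n i≤h)))

  v≼ℓ : ∀ {i} → i ≤ h → v i ≼ ℓ
  v≼ℓ {i} i≤h = h ∸ i , refl , trans (≡.sym (m∸n+n≡m i≤h)) (cong ((h ∸ i) +_) (≡.sym (height-v i≤h)))

  ≼ℓ⇒≡v : ∀ {w} → w ≼ ℓ → w ≡ v (height forest w)
  ≼ℓ⇒≡v {w} (k , e , hk) =
    trans (≡.sym e)
      (cong (climb ℓ) (≡.sym (trans (cong (_∸ height forest w) hk) (m+n∸n≡m k (height forest w)))))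

  v-injective : ∀ {i j} → i ≤ h → j ≤ h → v i ≡ v j → i ≡ j
  v-injective i≤h j≤h e = trans (≡.sym (height-v i≤h)) (trans (cong (height forest) e) (height-v j≤h))

  v-mono : ∀ {i j} → i ≤ j → j ≤ h → v i ≼ v j
  v-mono {i} {j} i≤j j≤h with ≼-linear (v≼ℓ (≤-trans i≤j j≤h)) (v≼ℓ j≤h)
  ... | inj₁ vi≼vj = vi≼vj
  ... | inj₂ vj≼vi = subst (λ k → v k ≼ v j) (≤-antisym j≤i i≤j) (≼-refl (v j))
    where
      j≤i : j ≤ i
      j≤i = subst₂ _≤_ (height-v j≤h) (height-v (≤-trans i≤j j≤h)) (≼⇒height≤ vj≼vi)

  parent-v : ∀ {i} → suc i ≤ h → parent forest (v (suc i)) ≡ just (v i)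
  parent-v {i} i<h with hasParent (v (suc i)) (subst (0 <_) (≡.sym (height-v i<h)) (s≤s z≤n))
  ... | p , ep = trans ep (cong just (trans (≼ℓ⇒≡v p≼ℓ) (cong v height-p)))
    where
      p≼ℓ : p ≼ ℓ
      p≼ℓ = ≼-trans (parent≼ ep) (v≼ℓ i<h)
      height-p : height forest p ≡ i
      height-p = suc-injective (trans (≡.sym (child-h forest _ p ep)) (height-v i<h))

  v-adj : ∀ {i} → suc i ≤ h → Adj G (v i) (v (suc i))
  v-adj i<h = parent-adj _ _ (parent-v i<h)

  JumpsTo : ℕ → ℕ → Set
  JumpsTo β a = Σ (Fin n) λ x → v (suc β) ≼ x × Adj G x (v a)

  record Lowpoint (β : ℕ) : Set where
    field
      a       : ℕ
      x       : Fin n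
      a<β     : a < β
      below   : v (suc β) ≼ x
      jump    : Adj G x (v a)
      minimal : ∀ {a′} → a′ < a → ¬ JumpsTo β a′

  v[1+β]≢vβ : ∀ {β} → suc β ≤ h → v (suc β) ≢ v β
  v[1+β]≢vβ {β} β<h e = 1+n≰n (≤-reflexive (v-injective β<h (≤-trans (n≤1+n β) β<h) e))

  v[1+β]⋠v0 : ∀ {β} → suc β ≤ h → ¬ v (suc β) ≼ v 0
  v[1+β]⋠v0 β<h below = n≮0 (subst₂ _≤_ (height-v β<h) (height-v {0} z≤n) (≼⇒height≤ below))

  jumpsTo? : ∀ β a → Dec (JumpsTo β a)
  jumpsTo? β a = any? (λ x → (v (suc β) ≼? x) ×-dec adj? G x (v a))

  -- Since G - v β is connected, the subtree of v (suc β) has an edge to a lower vertex of the branch.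
  jumps-down : TwoConnected G → ∀ {β} → 1 ≤ β → suc β ≤ h → ∃ λ a → a < β × JumpsTo β a
  jumps-down (_ , connected) {β} 1≤β β<h
    with Exits.exit N (v (suc β)) (connected (v β) (v (suc β)) (v 0) (v[1+β]≢vβ β<h) v0≢vβ)
                      (≼-refl _) (v[1+β]⋠v0 β<h)
    where
      v0≢vβ : v 0 ≢ v β
      v0≢vβ e = 1+n≰n (≤-trans 1≤β (≤-reflexive (≡.sym (v-injective {0} z≤n (≤-trans (n≤1+n β) β<h) e))))
  ... | x , z , below , xz , z≢vβ , z≼v[1+β] , z≢v[1+β] =
    height forest z , hz<β , x , below , subst (Adj G x) (≼ℓ⇒≡v z≼ℓ) xz
    where
      z≼ℓ : z ≼ ℓ
      z≼ℓ = ≼-trans z≼v[1+β] (v≼ℓ β<h)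
      hz≤β : height forest z ≤ β
      hz≤β = s≤s⁻¹ (≤∧≢⇒< (subst (height forest z ≤_) (height-v β<h) (≼⇒height≤ z≼v[1+β]))
               (λ e → z≢v[1+β] (≼∧height≡⇒≡ z≼v[1+β] (trans e (≡.sym (height-v β<h))))))
      hz<β : height forest z < β
      hz<β = ≤∧≢⇒< hz≤β (λ e → z≢vβ (trans (≼ℓ⇒≡v z≼ℓ) (cong v e)))

  opaque
    lowpoint : TwoConnected G → ∀ {β} → 1 ≤ β → suc β ≤ h → Lowpoint β
    lowpoint tc 1≤β β<h =
      let a₀ , a₀<β , jumps₀ = jumps-down tc 1≤β β<h
          a , a≤a₀ , (x , below , jump) , minimal = minimal-witness (jumpsTo? _) jumps₀
      in record { a = a ; x = x ; a<β = ≤-<-trans a≤a₀ a₀<β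
                ; below = below ; jump = jump ; minimal = minimal }

  record HangsAt (j : ℕ) (w : Fin n) : Set where
    field
      j≤h        : j ≤ h
      vj≼w       : v j ≼ w
      off-branch : ¬ w ≼ ℓ
      beside     : suc j ≤ h → ¬ v (suc j) ≼ w

  hangsAt-unique : ∀ {j j′ w} → HangsAt j w → HangsAt j′ w → j ≡ j′
  hangsAt-unique {j} {j′} r r′ with <-cmp j j′
  ... | tri≈ _ j≡j′ _ = j≡j′
  ... | tri< j<j′ _ _ = ⊥-elim (HangsAt.beside r (≤-trans j<j′ (HangsAt.j≤h r′))
                          (≼-trans (v-mono j<j′ (HangsAt.j≤h r′)) (HangsAt.vj≼w r′)))
  ... | tri> _ _ j′<j = ⊥-elim (HangsAt.beside r′ (≤-trans j′<j (HangsAt.j≤h r))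
                          (≼-trans (v-mono j′<j (HangsAt.j≤h r)) (HangsAt.vj≼w r)))

  -- path climbs from x through the tree until it first meets the branch, at v j.
  record Landing (b : ℕ) (x : Fin n) : Set where
    field
      j      : ℕ
      path   : List (Fin n)
      b≤j    : b ≤ j
      j≤h    : j ≤ h
      vj≼x   : v j ≼ x
      walk   : ∀ {u} → Adj G u x → Walk G u path (v j)
      unique : Unique path
      hangs  : ∀ {w} → w ∈ path → HangsAt j w
      path≼x : ∀ {w} → w ∈ path → w ≼ x
      lands  : x ≡ v j ⊎ HangsAt j x

  private
    landing′ : ∀ k {b x} → b ≤ h → v b ≼ x → height forest x ≡ k + b → Landing b x
    landing′ k {b} {x} b≤h vb≼x hx with x ≼? ℓ
    ... | yes x≼ℓ = record
      { j = height forest x ; path = [] ; b≤j = subst (b ≤_) (≡.sym hx) (m≤n+m b k)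
      ; j≤h = ≼⇒height≤ x≼ℓ ; vj≼x = subst (_≼ x) (≼ℓ⇒≡v x≼ℓ) (≼-refl x)
      ; walk = λ ux → edge (subst (Adj G _) (≼ℓ⇒≡v x≼ℓ) ux) ; unique = []
      ; hangs = λ () ; path≼x = λ () ; lands = inj₁ (≼ℓ⇒≡v x≼ℓ) }
    landing′ zero {b} {x} b≤h vb≼x hx | no x⋠ℓ =
      ⊥-elim (x⋠ℓ (subst (_≼ ℓ) (≼∧height≡⇒≡ vb≼x (trans (height-v b≤h) (≡.sym hx))) (v≼ℓ b≤h)))
    landing′ (suc k) {b} {x} b≤h vb≼x hx | no x⋠ℓ
      with hasParent x (subst (0 <_) (≡.sym hx) (s≤s z≤n))
    ... | p , ep = record
      { j = L.j ; path = x ∷ L.path ; b≤j = L.b≤j ; j≤h = L.j≤h ; vj≼x = vj≼x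
      ; walk = λ ux → ux ◅ L.walk (sym G (parent-adj x p ep))
      ; unique = unique-∷ x∉path L.unique
      ; hangs = λ { (here refl) → x-hangs ; (there w∈) → L.hangs w∈ }
      ; path≼x = λ { (here refl) → ≼-refl x ; (there w∈) → ≼-trans (L.path≼x w∈) p≼x }
      ; lands = inj₂ x-hangs }
      where
        L : Landing b p
        L = landing′ k b≤h (≼-parent vb≼x (λ e → x⋠ℓ (subst (_≼ ℓ) e (v≼ℓ b≤h))) ep)
                      (suc-injective (trans (≡.sym (child-h forest x p ep)) hx))
        module L = Landing L
        p≼x : p ≼ x
        p≼x = parent≼ ep
        vj≼x : v L.j ≼ x
        vj≼x = ≼-trans L.vj≼x p≼x
        x∉path : x ∉ L.path
        x∉path x∈ =
          1+n≰n (≤-trans (≤-reflexive (≡.sym (child-h forest x p ep))) (≼⇒height≤ (L.path≼x x∈)))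
        not-below-next : suc L.j ≤ h → ¬ v (suc L.j) ≼ x
        not-below-next j<h below with v (suc L.j) ≟F x
        ... | yes e = x⋠ℓ (subst (_≼ ℓ) e (v≼ℓ j<h))
        ... | no ne with L.lands
        ...   | inj₁ p≡vj = 1+n≰n (subst₂ _≤_ (height-v j<h) (height-v L.j≤h)
                                     (≼⇒height≤ (subst (v (suc L.j) ≼_) p≡vj (≼-parent below ne ep))))
        ...   | inj₂ p-hangs = HangsAt.beside p-hangs j<h (≼-parent below ne ep)
        x-hangs : HangsAt L.j x
        x-hangs = record { j≤h = L.j≤h ; vj≼w = vj≼x ; off-branch = x⋠ℓ ; beside = not-below-next }

  opaque
    landing : ∀ {b x} → b ≤ h → v b ≼ x → Landing b x
    landing {b} {x} b≤h vb≼x =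
      landing′ (height forest x ∸ b) b≤h vb≼x
        (≡.sym (m∸n+n≡m (subst (_≤ height forest x) (height-v b≤h) (≼⇒height≤ vb≼x))))

  segment : ℕ → ℕ → List (Fin n)
  segment b zero    = []
  segment b (suc e) = v (suc b) ∷ segment (suc b) e

  ∈-segment : ∀ b e {w} → w ∈ segment b e → Σ ℕ λ i → b < i × i ≤ b + e × w ≡ v i
  ∈-segment b (suc e) (here refl) =
    suc b , ≤-refl , subst (suc b ≤_) (≡.sym (+-suc b e)) (s≤s (m≤m+n b e)) , refl
  ∈-segment b (suc e) (there w∈) with ∈-segment (suc b) e w∈
  ... | i , b<i , i≤ , w≡ = i , <-trans (n<1+n b) b<i , subst (i ≤_) (≡.sym (+-suc b e)) i≤ , w≡

  length-segment : ∀ b e → length (segment b e) ≡ e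
  length-segment b zero    = refl
  length-segment b (suc e) = cong suc (length-segment (suc b) e)

  unique-segment : ∀ b e → b + e ≤ h → Unique (segment b e)
  unique-segment b zero    _      = []
  unique-segment b (suc e) b+e≤h = unique-∷ head∉ (unique-segment (suc b) e b+1+e≤h)
    where
      b+1+e≤h : suc b + e ≤ h
      b+1+e≤h = subst (_≤ h) (+-suc b e) b+e≤h
      head∉ : v (suc b) ∉ segment (suc b) e
      head∉ w∈ with ∈-segment (suc b) e w∈
      ... | i , b+1<i , i≤ , e′ =
        <-irrefl (v-injective (≤-trans (s≤s (m≤m+n b e)) b+1+e≤h) (≤-trans i≤ b+1+e≤h) e′) b+1<i

  walk-segment : ∀ b e {R w} → b + e ≤ h → Walk G (v (b + e)) R w → Walk G (v b) (segment b e ++ R) w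
  walk-segment b zero    {R} {w} _ p = subst (λ k → Walk G (v k) R w) (+-identityʳ b) p
  walk-segment b (suc e) {R} {w} b+e≤h p =
    v-adj (≤-trans (s≤s (m≤m+n b e)) b+1+e≤h) ◅
    walk-segment (suc b) e b+1+e≤h (subst (λ k → Walk G (v k) R w) (+-suc b e) p)
    where
      b+1+e≤h : suc b + e ≤ h
      b+1+e≤h = subst (_≤ h) (+-suc b e) b+e≤h

  Avoids : ℕ → ℕ → Fin n → Set
  Avoids b a w = ∀ i → b ≤ i → i ≤ a → w ≢ v i

  hangsAt⇒avoids : ∀ {j b a w} → HangsAt j w → a ≤ h → Avoids b a w
  hangsAt⇒avoids r a≤h i _ i≤a e =
    HangsAt.off-branch r (subst (_≼ ℓ) (≡.sym e) (v≼ℓ (≤-trans i≤a a≤h)))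

  -- The lowpoint edge at β followed by the tree path from its upper end back to the branch.
  record Jump (β : ℕ) : Set where
    field
      low     : Lowpoint β
      landed  : Landing (suc β) (Lowpoint.x low)
      gap     : ℕ
      j≡      : Landing.j landed ≡ suc (Lowpoint.a low + gap)
      1≤gap   : 1 ≤ gap

  opaque
    jump : TwoConnected G → ∀ {β} → 1 ≤ β → suc β ≤ h → Jump β
    jump tc {β} 1≤β β<h =
      let e , j≡ , 1≤e = gap-split (Lowpoint.a<β low) (Landing.b≤j landed) in
      record { low = low ; landed = landed ; gap = e ; j≡ = j≡ ; 1≤gap = 1≤e }
      where
        low : Lowpoint β
        low = lowpoint tc 1≤β β<h
        landed : Landing (suc β) (Lowpoint.x low)
        landed = landing β<h (Lowpoint.below low)

  1+[h∸1]≡h : 2 ≤ h → suc (h ∸ 1) ≡ h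
  1+[h∸1]≡h 2≤h = m+[n∸m]≡n (≤-trans (s≤s z≤n) 2≤h)

  topJump : TwoConnected G → 2 ≤ h → Jump (h ∸ 1)
  topJump tc 2≤h = jump tc (∸-monoˡ-≤ 1 2≤h) (≤-reflexive (1+[h∸1]≡h 2≤h))

  module _ (t : ℕ) (longest : ∀ k → HasCycle G k → k ≤ t) where

    -- A bypass W from v b to v (suc (b + e)) closes a cycle with the branch segment it avoids.
    bypass-bound : ∀ b e {W} → suc (b + e) ≤ h → Walk G (v b) W (v (suc (b + e))) → Unique W →
                   (∀ {w} → w ∈ W → Avoids b (suc (b + e)) w) → 1 ≤ length W ⊎ 1 ≤ e →
                   length W + e + 2 ≤ t
    bypass-bound b e {W} a≤h walk-W unique-W avoids nontrivial =
      subst (_≤ t) (trans (cong suc length-R) (length-arith (length W) e))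
        (longest _ (closedWalk⇒cycle walk-R (unique-∷ vb∉R unique-R) 2≤length-R))
      where
        a : ℕ
        a = suc (b + e)
        b+e≤h : b + e ≤ h
        b+e≤h = ≤-trans (n≤1+n _) a≤h
        b≤h : b ≤ h
        b≤h = ≤-trans (m≤m+n b e) b+e≤h
        O R : List (Fin n)
        O = segment b e
        R = W ++ v a ∷ reverse O
        walk-O : Walk G (v b) O (v a)
        walk-O = subst (λ L → Walk G (v b) L (v a)) (++-identityʳ O)
                   (walk-segment b e b+e≤h (edge (v-adj a≤h)))
        walk-R : Walk G (v b) R (v b)
        walk-R = walk-++ walk-W (walk-reverse walk-O)
        ∈-reverse-segment : ∀ {w} → w ∈ reverse O → Σ ℕ λ i → b < i × i ≤ b + e × w ≡ v i
        ∈-reverse-segment w∈ = ∈-segment b e (reverse⁻ w∈)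
        va∉ : v a ∉ reverse O
        va∉ w∈ with ∈-reverse-segment w∈
        ... | i , _ , i≤ , e′ = 1+n≰n (subst (_≤ b + e) (≡.sym (v-injective a≤h (≤-trans i≤ b+e≤h) e′)) i≤)
        unique-R : Unique R
        unique-R = ++⁺ unique-W (unique-∷ va∉ (unique-reverse (unique-segment b e b+e≤h))) disjoint
          where
            disjoint : ∀ {x} → ¬ (x ∈ W × x ∈ v a ∷ reverse O)
            disjoint (x∈W , here e′) = avoids x∈W a (≤-trans (m≤m+n b e) (n≤1+n _)) ≤-refl e′
            disjoint (x∈W , there x∈) with ∈-reverse-segment x∈
            ... | i , b<i , i≤ , e′ = avoids x∈W i (<⇒≤ b<i) (≤-trans i≤ (n≤1+n _)) e′
        vb∉R : v b ∉ R
        vb∉R vb∈ with ∈-++⁻ W vb∈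
        ... | inj₁ vb∈W = avoids vb∈W b ≤-refl (≤-trans (m≤m+n b e) (n≤1+n _)) refl
        ... | inj₂ (here e′) = <-irrefl (v-injective b≤h a≤h e′) (s≤s (m≤m+n b e))
        ... | inj₂ (there vb∈) with ∈-reverse-segment vb∈
        ...   | i , b<i , i≤ , e′ = <-irrefl (v-injective b≤h (≤-trans i≤ b+e≤h) e′) b<i
        length-R : length R ≡ length W + suc e
        length-R = trans (length-++ W)
                     (cong (λ k → length W + suc k) (trans (length-reverse O) (length-segment b e)))
        2≤length-R : 2 ≤ length R
        2≤length-R = subst (2 ≤_) (≡.sym length-R) (at-least-two nontrivial)
          where
            at-least-two : 1 ≤ length W ⊎ 1 ≤ e → 2 ≤ length W + suc e
            at-least-two (inj₁ 1≤W) = subst (2 ≤_) (≡.sym (+-suc (length W) e)) (s≤s (≤-trans 1≤W (m≤m+n _ e)))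
            at-least-two (inj₂ 1≤e) = ≤-trans (s≤s 1≤e) (m≤n+m (suc e) (length W))
        length-arith : ∀ w e → suc (w + suc e) ≡ w + e + 2
        length-arith = solve-∀

    jump-bound : ∀ {β} (J : Jump β) → length (Landing.path (Jump.landed J)) + Jump.gap J + 2 ≤ t
    jump-bound J =
      bypass-bound a gap a+gap<h (subst (λ k → Walk G (v a) path (v k)) j≡ (walk (sym G x-va)))
        unique (λ w∈ → hangsAt⇒avoids (hangs w∈) a+gap<h) (inj₂ 1≤gap)
      where
        open Jump J
        open Lowpoint low renaming (jump to x-va)
        open Landing landed
        a+gap<h : suc (a + gap) ≤ h
        a+gap<h = subst (_≤ h) j≡ j≤h

odd-jump-height : ∀ {h α c s w a e′ e i j} → h ≤ α + c * s + w → j + e ≡ α → j ≡ suc (a + e′) →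
                  i + e′ + 2 ≤ 3 + s → h ≤ a + suc c * s + (i + suc (e + w)) + 1
odd-jump-height {h} {α} {c} {s} {w} {a} {e′} {e} {i} {j} h≤ j+e≡α j≡ cycle≤ = begin
  h                                         ≤⟨ h≤ ⟩
  α + c * s + w                             ≡⟨ cong (λ k → k + c * s + w) (≡.sym j+e≡α) ⟩
  j + e + c * s + w                         ≡⟨ cong (λ k → k + e + c * s + w) j≡ ⟩
  suc (a + e′) + e + c * s + w
    ≤⟨ +-monoˡ-≤ w (+-monoˡ-≤ (c * s) (+-monoˡ-≤ e (s≤s (+-monoʳ-≤ a e′≤)))) ⟩
  suc (a + (1 + s)) + e + c * s + w         ≤⟨ m≤m+n _ i ⟩
  suc (a + (1 + s)) + e + c * s + w + i     ≡⟨ rearrange a s e c w i ⟩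
  a + suc c * s + (i + suc (e + w)) + 1     ∎
  where
    open ≤-Reasoning
    e′≤ : e′ ≤ 1 + s
    e′≤ = +-cancelʳ-≤ 2 e′ (1 + s)
            (≤-trans (+-monoˡ-≤ 2 (m≤n+m e′ i)) (subst (i + e′ + 2 ≤_) (+-comm 2 (1 + s)) cycle≤))
    rearrange : ∀ a s e c w i → suc (a + (1 + s)) + e + c * s + w + i ≡ a + suc c * s + (i + suc (e + w)) + 1
    rearrange = solve-∀

odd-jump-count : ∀ {c w i e} → 2 * c ≤ w → 2 * suc c ≤ i + suc (e + w) + 1
odd-jump-count {c} {w} {i} {e} 2c≤w = begin
  2 * suc c             ≡⟨ *-suc 2 c ⟩
  2 + 2 * c             ≤⟨ +-monoʳ-≤ 2 2c≤w ⟩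
  2 + w                 ≤⟨ m≤n+m (2 + w) (i + e) ⟩
  i + e + (2 + w)       ≡⟨ rearrange i e w ⟩
  i + suc (e + w) + 1   ∎
  where
    open ≤-Reasoning
    rearrange : ∀ i e w → i + e + (2 + w) ≡ i + suc (e + w) + 1
    rearrange = solve-∀

even-jump-height : ∀ {h β c s w i e} → h ≤ β + c * s + w + 1 → h ≤ β + c * s + (i + suc (e + w))
even-jump-height {h} {β} {c} {s} {w} {i} {e} h≤ =
  ≤-trans h≤ (≤-trans (m≤m+n _ (i + e)) (≤-reflexive (rearrange β (c * s) w i e)))
  where
    rearrange : ∀ β x w i e → β + x + w + 1 + (i + e) ≡ β + x + (i + suc (e + w))
    rearrange = solve-∀

even-jump-count : ∀ {c w i e} → 2 * c ≤ w + 1 → 2 * c ≤ i + suc (e + w)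
even-jump-count {c} {w} {i} {e} 2c≤ = ≤-trans 2c≤ (≤-trans (m≤m+n _ (i + e)) (≤-reflexive (rearrange w i e)))
  where
    rearrange : ∀ w i e → w + 1 + (i + e) ≡ i + suc (e + w)
    rearrange = solve-∀

private
  shorten : ∀ {w e s} → w + e + 2 ≤ 3 + s → w + e ≤ 1 + s
  shorten {w} {e} {s} cycle≤ = +-cancelʳ-≤ 2 (w + e) (1 + s) (subst (w + e + 2 ≤_) (+-comm 2 (1 + s)) cycle≤)

close-odd : ∀ {h α c s w e} → h ≤ α + c * s + w → α ≡ suc e → w + e + 2 ≤ 3 + s → 2 * c ≤ w →
            (2 * c + 1 ≤ 3 + s) × (h ≤ c * s + s + 2)
close-odd {h} {α} {c} {s} {w} {e} h≤ refl cycle≤ 2c≤w = count , bounded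
  where
    open ≤-Reasoning
    w+e≤ : w + e ≤ 1 + s
    w+e≤ = shorten {w} {e} {s} cycle≤
    count : 2 * c + 1 ≤ 3 + s
    count = begin
      2 * c + 1  ≤⟨ +-monoˡ-≤ 1 (≤-trans 2c≤w (≤-trans (m≤m+n w e) w+e≤)) ⟩
      1 + s + 1  ≡⟨ +-comm (1 + s) 1 ⟩
      2 + s      ≤⟨ n≤1+n _ ⟩
      3 + s      ∎
    bounded : h ≤ c * s + s + 2
    bounded = begin
      h                         ≤⟨ h≤ ⟩
      suc e + c * s + w         ≡⟨ rearrange e (c * s) w ⟩
      c * s + suc (w + e)       ≤⟨ +-monoʳ-≤ (c * s) (s≤s w+e≤) ⟩
      c * s + (2 + s)           ≡⟨ rearrange′ (c * s) s ⟩
      c * s + s + 2             ∎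
      where
        rearrange : ∀ e x w → suc e + x + w ≡ x + suc (w + e)
        rearrange = solve-∀
        rearrange′ : ∀ x s → x + (2 + s) ≡ x + s + 2
        rearrange′ = solve-∀

close-even : ∀ {h c s w e} → h ≤ c * s + w + 1 → w + e + 2 ≤ 3 + s → 2 * c ≤ w + 1 →
             (2 * c + 1 ≤ 3 + s) × (h ≤ c * s + s + 2)
close-even {h} {c} {s} {w} {e} h≤ cycle≤ 2c≤ = count , bounded
  where
    open ≤-Reasoning
    w≤ : w ≤ 1 + s
    w≤ = ≤-trans (m≤m+n w e) (shorten {w} {e} {s} cycle≤)
    count : 2 * c + 1 ≤ 3 + s
    count = begin
      2 * c + 1  ≤⟨ +-monoˡ-≤ 1 2c≤ ⟩
      w + 1 + 1  ≤⟨ +-monoˡ-≤ 1 (+-monoˡ-≤ 1 w≤) ⟩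
      1 + s + 1 + 1 ≡⟨ rearrange s ⟩
      3 + s      ∎
      where
        rearrange : ∀ s → 1 + s + 1 + 1 ≡ 3 + s
        rearrange = solve-∀
    bounded : h ≤ c * s + s + 2
    bounded = begin
      h                    ≤⟨ h≤ ⟩
      c * s + w + 1        ≤⟨ +-monoˡ-≤ 1 (+-monoʳ-≤ (c * s) w≤) ⟩
      c * s + (1 + s) + 1  ≡⟨ rearrange (c * s) s ⟩
      c * s + s + 2        ∎
      where
        rearrange : ∀ x s → x + (1 + s) + 1 ≡ x + s + 2
        rearrange = solve-∀

-- With t = 3 + s: (c + 1)(t - 1) - 2c = c s + s + 2, and 2c + 1 ≤ t forces c + 1 ≤ ⌊t/2⌋ or c = ⌊t/2⌋.
count⇒height≤ : ∀ {h c s} → 2 * c + 1 ≤ 3 + s → h ≤ c * s + s + 2 → h ≤ ((3 + s) / 2) * (3 + s ∸ 1)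
count⇒height≤ {h} {c} {s} 2c+1≤ h≤ = ≤-trans h≤ bound
  where
    q : ℕ
    q = (3 + s) / 2
    3+s≤1+2q : 3 + s ≤ 1 + q * 2
    3+s≤1+2q = ≤-trans (≤-reflexive (m≡m%n+[m/n]*n (3 + s) 2))
                 (+-monoˡ-≤ (q * 2) (s≤s⁻¹ (m%n<n (3 + s) 2)))
    c≤q : c ≤ q
    c≤q = *-cancelʳ-≤ c q 2 (subst (_≤ q * 2) (*-comm 2 c)
            (+-cancelʳ-≤ 1 (2 * c) (q * 2)
              (≤-trans 2c+1≤ (≤-trans 3+s≤1+2q (≤-reflexive (+-comm 1 (q * 2)))))))
    open ≤-Reasoning
    bound : c * s + s + 2 ≤ q * (2 + s)
    bound with m≤n⇒m<n∨m≡n c≤q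
    ... | inj₁ c<q = begin
      c * s + s + 2          ≤⟨ m≤m+n _ (2 * c) ⟩
      c * s + s + 2 + 2 * c  ≡⟨ rearrange c s ⟩
      suc c * (2 + s)        ≤⟨ *-monoˡ-≤ (2 + s) c<q ⟩
      q * (2 + s)            ∎
      where
        rearrange : ∀ c s → c * s + s + 2 + 2 * c ≡ suc c * (2 + s)
        rearrange = solve-∀
    ... | inj₂ refl = begin
      c * s + s + 2          ≡⟨ +-assoc (c * s) s 2 ⟩
      c * s + (s + 2)        ≤⟨ +-monoʳ-≤ (c * s) (≤-trans (≤-reflexive (+-comm s 2)) (s≤s⁻¹ 3+s≤1+2q)) ⟩
      c * s + c * 2          ≡⟨ rearrange c s ⟩
      c * (2 + s)            ∎
      where
        rearrange : ∀ c s → c * s + c * 2 ≡ c * (2 + s)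
        rearrange = solve-∀

module Sweep {n : ℕ} {G : Graph n} (N : NormalForest G) (tc : TwoConnected G) (ℓ : Fin n)
             (s : ℕ) (longest : ∀ k → HasCycle G k → k ≤ 3 + s) where
  open NormalForest N
  open Ancestry forest
  open Branch N ℓ

  Beyond : ℕ → Fin n → Set
  Beyond α w = (Σ ℕ λ i → α < i × i ≤ h × w ≡ v i) ⊎ (Σ ℕ λ j → HangsAt j w × (α < j ⊎ j ≡ h))

  beyond⇒avoids : ∀ {α b w} → α ≤ h → Beyond α w → Avoids b α w
  beyond⇒avoids α≤h (inj₁ (i′ , α<i′ , i′≤h , w≡)) i _ i≤α w≡vi =
    <-irrefl (≡.sym (v-injective i′≤h (≤-trans i≤α α≤h) (trans (≡.sym w≡) w≡vi))) (≤-<-trans i≤α α<i′)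
  beyond⇒avoids α≤h (inj₂ (_ , w-hangs , _)) = hangsAt⇒avoids w-hangs α≤h

  -- Bounds on h by the part of the branch not yet bypassed, s per completed pair of jumps,
  -- and the length of the bypass; every completed pair leaves two vertices on the bypass.
  Bound : Bool → ℕ → ℕ → ℕ → ℕ → Set
  Bound true  α β c w = (h ≤ α + c * s + w) × (2 * c ≤ w)
  Bound false α β c w = (h ≤ β + c * s + w + 1) × (2 * c ≤ w + 1)

  -- A walk from v β to v α avoiding v 0, …, v α, built from the jumps found so far; μ is where
  -- the last jump started, and its minimality is no-jump.
  record Bypass (β : ℕ) : Set where
    field
      α μ c      : ℕ
      path       : List (Fin n)
      odd        : Bool
      β<α        : β < α
      α≤h        : α ≤ h
      μ≤1+α      : μ ≤ suc α
      μ≤h        : μ ≤ h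
      no-jump    : ∀ {a x} → a < β → v μ ≼ x → ¬ Adj G x (v a)
      walk       : Walk G (v β) path (v α)
      unique     : Unique path
      beyond     : ∀ {w} → w ∈ path → Beyond α w
      nontrivial : 1 ≤ length path ⊎ suc β < α
      bound      : Bound odd α β c (length path)

  HeightBound : Set
  HeightBound = ∃ λ c → (2 * c + 1 ≤ 3 + s) × (h ≤ c * s + s + 2)

  close : Bypass 0 → HeightBound
  close B = c , by-parity odd bound
    where
      open Bypass B
      e : ℕ
      e = α ∸ 1
      α≡1+e : α ≡ suc e
      α≡1+e = ≡.sym (m+[n∸m]≡n β<α)
      cycle≤ : length path + e + 2 ≤ 3 + s
      cycle≤ = bypass-bound (3 + s) longest 0 e (subst (_≤ h) α≡1+e α≤h)
                 (subst (λ k → Walk G (v 0) path (v k)) α≡1+e walk) unique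
                 (λ w∈ → subst (λ k → Avoids 0 k _) α≡1+e (beyond⇒avoids α≤h (beyond w∈)))
                 (map₂ (λ 1<α → s≤s⁻¹ (subst (1 <_) α≡1+e 1<α)) nontrivial)
      by-parity : (o : Bool) → Bound o α 0 c (length path) → (2 * c + 1 ≤ 3 + s) × (h ≤ c * s + s + 2)
      by-parity true  (h≤ , 2c≤) = close-odd {c = c} h≤ α≡1+e cycle≤ 2c≤
      by-parity false (h≤ , 2c≤) = close-even {c = c} h≤ cycle≤ 2c≤

  -- The jump at β lands at v j with β < j ≤ α (by no-jump); the new bypass runs from v a along the jump
  -- to v j, up the branch to v α and back along the old bypass to v β.
  module Extension {β₀ : ℕ} (B : Bypass (suc β₀)) where
    open Bypass B
    β : ℕ
    β = suc β₀

    β<h : suc β ≤ h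
    β<h = ≤-trans β<α α≤h

    β≤h : β ≤ h
    β≤h = ≤-trans (n≤1+n β) β<h

    J : Jump β
    J = jump tc (s≤s z≤n) β<h

    open Jump J
    open Lowpoint low public using (a; a<β)
    open Lowpoint low using (minimal) renaming (jump to x-va)
    module L = Landing landed
    j : ℕ
    j = L.j

    j<μ : j < μ
    j<μ with μ ≤? j
    ... | yes μ≤j = ⊥-elim (no-jump a<β (≼-trans (v-mono μ≤j L.j≤h) L.vj≼x) x-va)
    ... | no μ≰j  = ≰⇒> μ≰j

    j≤α : j ≤ α
    j≤α = s≤s⁻¹ (≤-trans j<μ μ≤1+α)

    j<h : j < h
    j<h = ≤-trans j<μ μ≤h

    e : ℕ
    e = α ∸ j

    j+e≡α : j + e ≡ α
    j+e≡α = m+[n∸m]≡n j≤α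

    O R path′ : List (Fin n)
    O = segment j e
    R = O ++ reverse path
    path′ = L.path ++ v j ∷ R

    walk′ : Walk G (v a) path′ (v β)
    walk′ = walk-++ (L.walk (sym G x-va))
              (walk-segment j e (subst (_≤ h) (≡.sym j+e≡α) α≤h)
                (subst (λ k → Walk G (v k) (reverse path) (v β)) (≡.sym j+e≡α) (walk-reverse walk)))

    ∈O : ∀ {x} → x ∈ O → Σ ℕ λ i → j < i × i ≤ α × x ≡ v i
    ∈O x∈ with ∈-segment j e x∈
    ... | i , j<i , i≤ , x≡ = i , j<i , subst (i ≤_) j+e≡α i≤ , x≡

    ∈old-avoids : ∀ {x} → x ∈ reverse path → Avoids 0 α x
    ∈old-avoids x∈ = beyond⇒avoids α≤h (beyond (reverse⁻ x∈))

    unique′ : Unique path′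
    unique′ = ++⁺ L.unique (unique-∷ vj∉R unique-R) disjoint
      where
        unique-R : Unique R
        unique-R = ++⁺ (unique-segment j e (subst (_≤ h) (≡.sym j+e≡α) α≤h)) (unique-reverse unique)
                     λ (x∈O , x∈W) → let i , _ , i≤α , x≡ = ∈O x∈O in ∈old-avoids x∈W i z≤n i≤α x≡
        vj∉R : v j ∉ R
        vj∉R vj∈ with ∈-++⁻ O vj∈
        ... | inj₁ vj∈O = let i , j<i , i≤α , vj≡ = ∈O vj∈O in
                          <-irrefl (v-injective L.j≤h (≤-trans i≤α α≤h) vj≡) j<i
        ... | inj₂ vj∈W = ∈old-avoids vj∈W j z≤n j≤α refl
        disjoint : ∀ {x} → ¬ (x ∈ L.path × x ∈ v j ∷ R)
        disjoint (x∈I , here x≡vj) = hangsAt⇒avoids (L.hangs x∈I) L.j≤h j z≤n ≤-refl x≡vj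
        disjoint (x∈I , there x∈R) with ∈-++⁻ O x∈R
        ... | inj₁ x∈O = let i , _ , i≤α , x≡ = ∈O x∈O in hangsAt⇒avoids (L.hangs x∈I) α≤h i z≤n i≤α x≡
        ... | inj₂ x∈W with beyond (reverse⁻ x∈W)
        ...   | inj₁ (i , _ , i≤h , x≡) = hangsAt⇒avoids (L.hangs x∈I) i≤h i z≤n ≤-refl x≡
        ...   | inj₂ (j′ , x-hangs , inj₁ α<j′) =
          <-irrefl (hangsAt-unique (L.hangs x∈I) x-hangs) (≤-<-trans j≤α α<j′)
        ...   | inj₂ (j′ , x-hangs , inj₂ j′≡h) =
          <-irrefl (trans (hangsAt-unique (L.hangs x∈I) x-hangs) j′≡h) j<h

    beyond′ : ∀ {w} → w ∈ path′ → Beyond β w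
    beyond′ w∈ with ∈-++⁻ L.path w∈
    ... | inj₁ w∈I = inj₂ (j , L.hangs w∈I , inj₁ L.b≤j)
    ... | inj₂ (here w≡vj) = inj₁ (j , L.b≤j , L.j≤h , w≡vj)
    ... | inj₂ (there w∈R) with ∈-++⁻ O w∈R
    ...   | inj₁ w∈O =
      let i , j<i , i≤α , w≡ = ∈O w∈O in inj₁ (i , <-trans L.b≤j j<i , ≤-trans i≤α α≤h , w≡)
    ...   | inj₂ w∈W with beyond (reverse⁻ w∈W)
    ...     | inj₁ (i , α<i , i≤h , w≡) = inj₁ (i , <-trans β<α α<i , i≤h , w≡)
    ...     | inj₂ (j′ , w-hangs , inj₁ α<j′) = inj₂ (j′ , w-hangs , inj₁ (<-trans β<α α<j′))
    ...     | inj₂ (j′ , w-hangs , inj₂ j′≡h) = inj₂ (j′ , w-hangs , inj₂ j′≡h)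

    length-path′ : length path′ ≡ length L.path + suc (e + length path)
    length-path′ = trans (length-++ L.path)
      (cong (λ k → length L.path + suc k)
        (trans (length-++ O) (cong₂ _+_ (length-segment j e) (length-reverse path))))

    bound′ : (o : Bool) → Bound o α β c (length path) → ∃ λ c′ → Bound (not o) β a c′ (length path′)
    bound′ true (h≤ , 2c≤) rewrite length-path′ =
      suc c ,
      odd-jump-height {c = c} {a = a} {i = length L.path} h≤ j+e≡α j≡ (jump-bound (3 + s) longest J) ,
      odd-jump-count {c = c} {i = length L.path} {e = e} 2c≤
    bound′ false (h≤ , 2c≤) rewrite length-path′ =
      c , even-jump-height {β = β} {c = c} {s = s} {w = length path} {i = length L.path} {e = e} h≤ ,
      even-jump-count {c = c} {i = length L.path} {e = e} 2c≤

    next : Bypass a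
    next = record
      { α = β ; μ = suc β ; c = proj₁ bound″ ; path = path′ ; odd = not odd
      ; β<α = a<β ; α≤h = β≤h ; μ≤1+α = ≤-refl ; μ≤h = β<h
      ; no-jump = λ a′<a below x-va′ → minimal a′<a (_ , below , x-va′)
      ; walk = walk′ ; unique = unique′ ; beyond = beyond′
      ; nontrivial =
          inj₁ (subst (1 ≤_) (≡.sym length-path′) (≤-trans (s≤s z≤n) (m≤n+m _ (length L.path))))
      ; bound = proj₂ bound″ }
      where
        bound″ : ∃ λ c′ → Bound (not odd) β a c′ (length path′)
        bound″ = bound′ odd bound

  sweep : ∀ k {β} → β < k → Bypass β → HeightBound
  sweep (suc k) {zero}   _   B = close B
  sweep (suc k) {suc β₀} β<k B = sweep k (≤-trans a<β (s≤s⁻¹ β<k)) next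
    where open Extension B

  initialBypass : 2 ≤ h → ∃ Bypass
  initialBypass 2≤h = a , record
    { α = h ; μ = h ; c = 0 ; path = L.path ; odd = true
    ; β<α = ≤-trans a<β (≤-trans (n≤1+n _) top<h) ; α≤h = ≤-refl ; μ≤1+α = n≤1+n h ; μ≤h = ≤-refl
    ; no-jump = λ a′<a below x-va′ →
        minimal a′<a (_ , subst (λ k → v k ≼ _) (≡.sym (1+[h∸1]≡h 2≤h)) below , x-va′)
    ; walk = subst (λ k → Walk G (v a) L.path (v k)) j≡h (L.walk (sym G x-va))
    ; unique = L.unique
    ; beyond = λ w∈ → inj₂ (L.j , L.hangs w∈ , inj₂ j≡h)
    ; nontrivial = inj₂ (≤-trans (s≤s a<β) top<h)
    ; bound = ≤-trans (m≤m+n h 0) (m≤m+n (h + 0) (length L.path)) , z≤n }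
    where
      top<h : suc (h ∸ 1) ≤ h
      top<h = ≤-reflexive (1+[h∸1]≡h 2≤h)
      open Jump (topJump tc 2≤h)
      open Lowpoint low using (a; a<β; minimal) renaming (jump to x-va)
      module L = Landing landed
      j≡h : L.j ≡ h
      j≡h = ≤-antisym L.j≤h (subst (_≤ L.j) (1+[h∸1]≡h 2≤h) L.b≤j)

  height≤ : 2 ≤ h → h ≤ ((3 + s) / 2) * (3 + s ∸ 1)
  height≤ 2≤h =
    let a , B = initialBypass 2≤h
        c , count , h≤ = sweep (suc a) ≤-refl B
    in count⇒height≤ {c = c} count h≤

third-vertex : ∀ {n} → 3 ≤ n → (a b : Fin n) → ∃ λ u → u ≢ a × u ≢ b
third-vertex {suc (suc (suc m))} (s≤s (s≤s (s≤s _))) a b with a ≟F b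
... | yes refl = punchIn a fzero , punchInᵢ≢i a fzero , punchInᵢ≢i a fzero
... | no a≢b   = punchIn a j , punchInᵢ≢i a j , λ u≡b →
  punchInᵢ≢i (punchOut a≢b) fzero (punchIn-injective a _ _ (trans u≡b (≡.sym (punchIn-punchOut a≢b))))
  where
    j : Fin (suc (suc m))
    j = punchIn (punchOut a≢b) fzero

longest-cycle : ∀ {n t} {G : Graph n} → Circumference G t → ∀ k → HasCycle G k → k ≤ t
longest-cycle (inj₁ (_ , acyclic)) k cycle = ⊥-elim (acyclic k cycle)
longest-cycle (inj₂ (_ , longest)) = longest

module Heights {n : ℕ} {G : Graph n} (N : NormalForest G) (tc : TwoConnected G) where
  open NormalForest N
  open Ancestry forest

  -- A vertex of height 1 is not the only non-root vertex, since removing the root keeps G connected.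
  deep-vertex : ∀ y → height forest y ≡ 1 → ∃ λ u → 2 ≤ height forest u
  deep-vertex y hy with hasParent y (subst (0 <_) (≡.sym hy) (s≤s z≤n))
  ... | p , ep = below-y (third-vertex (proj₁ tc) y p)
    where
      hp : height forest p ≡ 0
      hp = suc-injective (trans (≡.sym (child-h forest y p ep)) hy)
      y≢p : y ≢ p
      y≢p e = 1+n≢0 (trans (≡.sym hy) (trans (cong (height forest) e) hp))
      p-root : parent forest p ≡ nothing
      p-root with parent forest p in eq
      ... | nothing = refl
      ... | just q  = ⊥-elim (1+n≢0 (trans (≡.sym (child-h forest p q eq)) hp))
      below-y : (∃ λ u → u ≢ y × u ≢ p) → ∃ λ u → 2 ≤ height forest u
      below-y (u , u≢y , u≢p) with y ≼? u
      ... | yes y≼u = u , ≤∧≢⇒< (subst (_≤ height forest u) hy (≼⇒height≤ y≼u))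
                                (λ e → u≢y (≡.sym (≼∧height≡⇒≡ y≼u (trans hy e))))
      ... | no y⋠u with Exits.exit N y (proj₂ tc p y u y≢p u≢p) (≼-refl y) y⋠u
      ...   | _ , z , _ , _ , z≢p , z≼y , z≢y = ⊥-elim (z≢p (≼-root p-root (≼-parent z≼y z≢y ep)))

  module _ (t : ℕ) (longest : ∀ k → HasCycle G k → k ≤ t) where

    circumference≥3 : ∀ ℓ → 2 ≤ height forest ℓ → 3 ≤ t
    circumference≥3 ℓ 2≤h =
      ≤-trans (+-monoˡ-≤ 2 (≤-trans 1≤gap (m≤n+m gap _))) (jump-bound t longest J)
      where
        open Branch N ℓ
        J : Jump (h ∸ 1)
        J = topJump tc 2≤h
        open Jump J

    deep-height≤ : ∀ ℓ → 2 ≤ height forest ℓ → height forest ℓ ≤ (t / 2) * (t ∸ 1)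
    deep-height≤ ℓ 2≤h =
      subst (λ k → height forest ℓ ≤ (k / 2) * (k ∸ 1)) 3+s≡t (Sweep.height≤ N tc ℓ s longest′ 2≤h)
      where
        s : ℕ
        s = t ∸ 3
        3+s≡t : 3 + s ≡ t
        3+s≡t = m+[n∸m]≡n (circumference≥3 ℓ 2≤h)
        longest′ : ∀ k → HasCycle G k → k ≤ 3 + s
        longest′ k cycle = subst (k ≤_) (≡.sym 3+s≡t) (longest k cycle)

    height≤ : ∀ v → height forest v ≤ (t / 2) * (t ∸ 1)
    height≤ v with height forest v in hv
    ... | zero        = z≤n
    ... | suc zero    =
      let u , 2≤hu = deep-vertex v hv in ≤-trans (≤-trans (s≤s z≤n) 2≤hu) (deep-height≤ u 2≤hu)
    ... | suc (suc _) =
      subst (_≤ (t / 2) * (t ∸ 1)) hv (deep-height≤ v (subst (2 ≤_) (≡.sym hv) (s≤s (s≤s z≤n))))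

lemma3 : ∀ (t : ℕ) {n : ℕ} (G : Graph n) → TwoConnected G → Circumference G t →
    TreedepthAtMost G ((t / 2) * (t ∸ 1) + 1)
lemma3 t G tc circumference =
  forest ,
  (λ u v uv → comparable⇒closureAdj (adj⇒comparable u v uv) (λ { refl → irrefl G uv })) ,
  (λ v → +-monoˡ-≤ 1 (height≤ t (longest-cycle circumference) v))
  where
    N : NormalForest G
    N = normalForest G
    open NormalForest N
    open Ancestry forest
    open Heights N tc
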